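{- Let $P=(P,\sqsubseteq)$ be a poset. Then $\mathscr A(P)$ is a lattice if and only if for all $A,B\in\mathscr A(P)$ there is $C\in\mathscr A(P)$ with $\downarrow A\cap\downarrow B=\downarrow C$; in that case $A\wedge B=C$, and moreover $\mathscr A(P)$ is distributive. In particular, if $P$ is a $\sqcap$-semilattice and $\mathscr A(P)$ is a lattice, then the meet of $A,B\in\mathscr A(P)$ is the set of maximal elements of $\{a\sqcap b: a\in A, b\in B\}$.
   Context: For $X\subseteq P$, $\downarrow X=\{y\in P:\exists x\in X,\ y\sqsubseteq x\}$. $\mathscr A(P)$ is the set of antichains of $P$ ordered by $A\le B$ iff $\downarrow A\subseteq\downarrow B$. -}

module Defs where

open import Level using (Level; _⊔_)
open import Data.Product using (Σ; ∃; _×_; _,_; proj₁)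
open import Relation.Unary using (Pred; _∈_; _⊆_; _∩_)
open import Relation.Binary using (Poset)
open import Relation.Binary.Lattice.Structures using (IsLattice)
open import Function.Bundles using (_⇔_)

-- Everything is relative to a poset P = (Carrier, _≈_, _≤_) (stdlib Poset,
-- where ⊑ of the paper is _≤_ and equality is the setoid equality _≈_).
module AntichainsOf {c ℓ₁ ℓ₂ : Level} (P : Poset c ℓ₁ ℓ₂) where
  open Poset P

  ℓ : Level
  ℓ = c ⊔ ℓ₁ ⊔ ℓ₂

  Subset : Set _
  Subset = Pred Carrier ℓ

  ↓ : Subset → Subset
  ↓ X y = ∃ λ x → X x × y ≤ x

  IsAntichain : Subset → Set ℓ
  IsAntichain X = ∀ {x y} → X x → X y → x ≤ y → x ≈ y

  Antichain : Set _
  Antichain = Σ Subset IsAntichain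

  set : Antichain → Subset
  set = proj₁

  _≤A_ : Antichain → Antichain → Set ℓ
  A ≤A B = ↓ (set A) ⊆ ↓ (set B)

  _≈A_ : Antichain → Antichain → Set ℓ
  A ≈A B = (A ≤A B) × (B ≤A A)

  IsLatticeA : Set _
  IsLatticeA = Σ (Antichain → Antichain → Antichain) λ _∨_ →
               Σ (Antichain → Antichain → Antichain) λ _∧_ →
               IsLattice _≈A_ _≤A_ _∨_ _∧_

  DownMeet : Antichain → Antichain → Antichain → Set ℓ
  DownMeet A B C = (↓ (set A) ∩ ↓ (set B) ⊆ ↓ (set C))
                 × (↓ (set C) ⊆ ↓ (set A) ∩ ↓ (set B))

  MeetCondition : Set _
  MeetCondition = ∀ (A B : Antichain) → ∃ λ (C : Antichain) → DownMeet A B C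

  Max : Subset → Subset
  Max S x = S x × (∀ y → S y → x ≤ y → x ≈ y)

  Meets : (Carrier → Carrier → Carrier) → Antichain → Antichain → Subset
  Meets _⊓_ A B y = ∃ λ a → ∃ λ b → set A a × set B b × y ≈ (a ⊓ b)

-- ↓ turns the order of 𝒜(P) into inclusion of down-sets, and down-sets are closed
-- under unions and intersections.  Joins always exist: ↓(A ∨ B) = ↓A ∪ ↓B with
-- A ∨ B the maximal elements of A ∪ B: by excluded middle, an element of A ∪ B that
-- is not maximal lies strictly below an element of the other antichain, and that
-- element is maximal.  Comparing with a principal antichain {y} shows that a
-- meet C of A and B must satisfy ↓C = ↓A ∩ ↓B.  So 𝒜(P) is a lattice exactly when
-- these intersections are again down-sets of antichains, and it is then distributive
-- because intersection distributes over union.  In a ⊓-semilattice, ↓A ∩ ↓B is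
-- generated by the elements a ⊓ b, so its maximal elements are the maximal such meets.
module Submission where

open import Defs
open import Level using (Level; _⊔_; Lift; lift; lower)
open import Data.Product using (Σ; ∃; _×_; _,_; proj₁; proj₂)
open import Data.Sum using (inj₁; inj₂; [_,_])
open import Data.Empty using (⊥-elim)
open import Relation.Nullary using (¬_; yes; no)
open import Relation.Unary using (_∩_; _∪_; _⊆_)
open import Relation.Binary using (Poset; IsPartialOrder)
open import Relation.Binary.Lattice.Structures
  using (IsLattice; IsDistributiveLattice; IsMeetSemilattice; IsJoinSemilattice)
open import Function.Bundles using (_⇔_; mk⇔)
open import Axiom.ExcludedMiddle using (ExcludedMiddle)
open import Axiom.DoubleNegationElimination using (em⇒dne)

module AntichainLattice {c ℓ₁ ℓ₂ : Level} (P : Poset c ℓ₁ ℓ₂) where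
  open Poset P
  open AntichainsOf P

  ≤A-isPartialOrder : IsPartialOrder _≈A_ _≤A_
  ≤A-isPartialOrder = record
    { isPreorder = record
      { isEquivalence = record
        { refl  = (λ p → p) , (λ p → p)
        ; sym   = λ (A≤B , B≤A) → B≤A , A≤B
        ; trans = λ (A≤B , B≤A) (B≤C , C≤B) → (λ p → B≤C (A≤B p)) , (λ p → B≤A (C≤B p))
        }
      ; reflexive = proj₁
      ; trans     = λ A≤B B≤C p → B≤C (A≤B p)
      }
    ; antisym = _,_
    }

  Max-isAntichain : (S : Subset) → IsAntichain (Max S)
  Max-isAntichain S (_ , x-max) (Sy , _) = x-max _ Sy

  antichain⊆Max-↓ : (C : Antichain) → set C ⊆ Max (↓ (set C))
  antichain⊆Max-↓ C {x} Cx = (x , Cx , refl) , λ y (z , Cz , y≤z) x≤y →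
    antisym x≤y (trans y≤z (reflexive (Eq.sym (proj₂ C Cx Cz (trans x≤y y≤z)))))

  singleton : Carrier → Antichain
  singleton y = (λ x → Lift ℓ (x ≈ y))
              , λ (lift x≈y) (lift z≈y) _ → Eq.trans x≈y (Eq.sym z≈y)

  ∈-↓-singleton : ∀ y → ↓ (set (singleton y)) y
  ∈-↓-singleton y = y , lift Eq.refl , refl

  singleton-≤A : ∀ {y} (A : Antichain) → ↓ (set A) y → singleton y ≤A A
  singleton-≤A A (a , Aa , y≤a) (x , lift x≈y , z≤x) = a , Aa , trans (trans z≤x (reflexive x≈y)) y≤a

  _∨ₘ_ : Antichain → Antichain → Antichain
  A ∨ₘ B = Max (set A ∪ set B) , Max-isAntichain (set A ∪ set B)

  ↓-∨ₘ⊆ : ∀ A B → ↓ (set (A ∨ₘ B)) ⊆ ↓ (set A) ∪ ↓ (set B)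
  ↓-∨ₘ⊆ A B (m , (inj₁ Am , _) , y≤m) = inj₁ (m , Am , y≤m)
  ↓-∨ₘ⊆ A B (m , (inj₂ Bm , _) , y≤m) = inj₂ (m , Bm , y≤m)

  strictly-above-antichain⇒maximal : ∀ (X Y : Antichain) {x y} → set X x → set Y y →
    x ≤ y → ¬ x ≈ y → ∀ {z} → (set X ∪ set Y) z → y ≤ z → y ≈ z
  strictly-above-antichain⇒maximal X Y Xx Yy x≤y x≉y (inj₁ Xz) y≤z =
    ⊥-elim (x≉y (proj₂ (antichain⊆Max-↓ X Xx) _ (_ , Xz , y≤z) x≤y))
  strictly-above-antichain⇒maximal X Y Xx Yy x≤y x≉y (inj₂ Yz) y≤z = proj₂ Y Yy Yz y≤z

  module _ (em : ExcludedMiddle ℓ) where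

    below-Max-∪ : ∀ A B {a} → (set A ∪ set B) a → ∃ λ m → Max (set A ∪ set B) m × a ≤ m
    below-Max-∪ A B {a} ABa with em {∃ λ y → (set A ∪ set B) y × a ≤ y × ¬ a ≈ y}
    ... | yes (y , ABy , a≤y , a≉y) = y , (ABy , y-max ABa ABy) , a≤y
      where
      swap-∪ : ∀ {z} → (set A ∪ set B) z → (set B ∪ set A) z
      swap-∪ = [ inj₂ , inj₁ ]

      y-max : (set A ∪ set B) a → (set A ∪ set B) y → ∀ z → (set A ∪ set B) z → y ≤ z → y ≈ z
      y-max (inj₁ Aa) (inj₁ Ay) _ _ _ = ⊥-elim (a≉y (proj₂ A Aa Ay a≤y))
      y-max (inj₂ Ba) (inj₂ By) _ _ _ = ⊥-elim (a≉y (proj₂ B Ba By a≤y))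
      y-max (inj₁ Aa) (inj₂ By) _ ABz = strictly-above-antichain⇒maximal A B Aa By a≤y a≉y ABz
      y-max (inj₂ Ba) (inj₁ Ay) _ ABz = strictly-above-antichain⇒maximal B A Ba Ay a≤y a≉y (swap-∪ ABz)
    ... | no nothing-above = a , (ABa , a-max) , refl
      where
      a-max : ∀ z → (set A ∪ set B) z → a ≤ z → a ≈ z
      a-max z ABz a≤z = lower (em⇒dne em {Lift ℓ (a ≈ z)} λ a≉z →
        nothing-above (z , ABz , a≤z , λ a≈z → a≉z (lift a≈z)))

    ↓-∨ₘ⊇ : ∀ A B → ↓ (set A) ∪ ↓ (set B) ⊆ ↓ (set (A ∨ₘ B))
    ↓-∨ₘ⊇ A B (inj₁ (a , Aa , y≤a)) with below-Max-∪ A B (inj₁ Aa)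
    ... | m , Mm , a≤m = m , Mm , trans y≤a a≤m
    ↓-∨ₘ⊇ A B (inj₂ (b , Bb , y≤b)) with below-Max-∪ A B (inj₂ Bb)
    ... | m , Mm , b≤m = m , Mm , trans y≤b b≤m

    ∨ₘ-isJoinSemilattice : IsJoinSemilattice _≈A_ _≤A_ _∨ₘ_
    ∨ₘ-isJoinSemilattice = record
      { isPartialOrder = ≤A-isPartialOrder
      ; supremum       = λ A B → (λ p → ↓-∨ₘ⊇ A B (inj₁ p))
                               , (λ p → ↓-∨ₘ⊇ A B (inj₂ p))
                               , λ Z A≤Z B≤Z p → [ A≤Z , B≤Z ] (↓-∨ₘ⊆ A B p)
      }

    ↓-∨⊆ : ∀ {_∨_} → IsJoinSemilattice _≈A_ _≤A_ _∨_ →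
           ∀ A B → ↓ (set (A ∨ B)) ⊆ ↓ (set A) ∪ ↓ (set B)
    ↓-∨⊆ isJoin A B p = ↓-∨ₘ⊆ A B (∨-least {z = A ∨ₘ B} (x≤x∨y A B) (y≤x∨y A B) p)
      where
      open IsJoinSemilattice isJoin using (∨-least)
      open IsJoinSemilattice ∨ₘ-isJoinSemilattice using (x≤x∨y; y≤x∨y)

  ↓-∨⊇ : ∀ {_∨_} → IsJoinSemilattice _≈A_ _≤A_ _∨_ →
         ∀ A B → ↓ (set A) ∪ ↓ (set B) ⊆ ↓ (set (A ∨ B))
  ↓-∨⊇ isJoin A B = [ x≤x∨y A B , y≤x∨y A B ]
    where open IsJoinSemilattice isJoin using (x≤x∨y; y≤x∨y)

  module DownSetOfMeet {_∧_ : Antichain → Antichain → Antichain}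
                       (isMeet : IsMeetSemilattice _≈A_ _≤A_ _∧_) where
    open IsMeetSemilattice isMeet using (x∧y≤x; x∧y≤y; ∧-greatest)

    ↓-∧⊆ : ∀ A B → ↓ (set (A ∧ B)) ⊆ ↓ (set A) ∩ ↓ (set B)
    ↓-∧⊆ A B p = x∧y≤x A B p , x∧y≤y A B p

    ↓-∧⊇ : ∀ A B → ↓ (set A) ∩ ↓ (set B) ⊆ ↓ (set (A ∧ B))
    ↓-∧⊇ A B {y} (yA , yB) =
      ∧-greatest {x = singleton y} (singleton-≤A A yA) (singleton-≤A B yB) (∈-↓-singleton y)

    ∧-downMeet : ∀ A B → DownMeet A B (A ∧ B)
    ∧-downMeet A B = ↓-∧⊇ A B , ↓-∧⊆ A B

    downMeet⇒≈A-∧ : ∀ A B C → DownMeet A B C → (A ∧ B) ≈A C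
    downMeet⇒≈A-∧ A B C (∩⊆C , C⊆∩) = (λ p → ∩⊆C (↓-∧⊆ A B p)) , (λ p → ↓-∧⊇ A B (C⊆∩ p))

  meetCondition⇒isLatticeA : ExcludedMiddle ℓ → MeetCondition → IsLatticeA
  meetCondition⇒isLatticeA em meet = _∨ₘ_ , (λ A B → proj₁ (meet A B)) , record
    { isPartialOrder = ≤A-isPartialOrder
    ; supremum       = IsJoinSemilattice.supremum (∨ₘ-isJoinSemilattice em)
    ; infimum        = λ A B → let (_ , ∩⊆C , C⊆∩) = meet A B in
                               (λ p → proj₁ (C⊆∩ p)) , (λ p → proj₂ (C⊆∩ p))
                             , λ Z Z≤A Z≤B p → ∩⊆C (Z≤A p , Z≤B p)
    }

  isLatticeA⇒meetCondition : IsLatticeA → MeetCondition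
  isLatticeA⇒meetCondition (_ , _∧_ , isLattice) A B =
    A ∧ B , DownSetOfMeet.∧-downMeet (IsLattice.isMeetSemilattice isLattice) A B

  isDistributive : ExcludedMiddle ℓ → ∀ {_∨_ _∧_} → IsLattice _≈A_ _≤A_ _∨_ _∧_ →
                   IsDistributiveLattice _≈A_ _≤A_ _∨_ _∧_
  isDistributive em {_∨_} {_∧_} isLattice = record
    { isLattice    = isLattice
    ; ∧-distribˡ-∨ = λ A B C → distrib-≤ A B C , distrib-≥ A B C
    }
    where
    open IsLattice isLattice using (isJoinSemilattice; isMeetSemilattice)
    open DownSetOfMeet isMeetSemilattice using (↓-∧⊆; ↓-∧⊇)

    distrib-≤ : ∀ A B C → (A ∧ (B ∨ C)) ≤A ((A ∧ B) ∨ (A ∧ C))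
    distrib-≤ A B C p with ↓-∧⊆ A (B ∨ C) p
    ... | pA , pB∨C with ↓-∨⊆ em isJoinSemilattice B C pB∨C
    ... | inj₁ pB = ↓-∨⊇ isJoinSemilattice (A ∧ B) (A ∧ C) (inj₁ (↓-∧⊇ A B (pA , pB)))
    ... | inj₂ pC = ↓-∨⊇ isJoinSemilattice (A ∧ B) (A ∧ C) (inj₂ (↓-∧⊇ A C (pA , pC)))

    distrib-≥ : ∀ A B C → ((A ∧ B) ∨ (A ∧ C)) ≤A (A ∧ (B ∨ C))
    distrib-≥ A B C p with ↓-∨⊆ em isJoinSemilattice (A ∧ B) (A ∧ C) p
    ... | inj₁ pA∧B = let (pA , pB) = ↓-∧⊆ A B pA∧B in
                      ↓-∧⊇ A (B ∨ C) (pA , ↓-∨⊇ isJoinSemilattice B C (inj₁ pB))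
    ... | inj₂ pA∧C = let (pA , pC) = ↓-∧⊆ A C pA∧C in
                      ↓-∧⊇ A (B ∨ C) (pA , ↓-∨⊇ isJoinSemilattice B C (inj₂ pC))

  module _ {_⊓_ : Carrier → Carrier → Carrier} (isMeetSemilattice : IsMeetSemilattice _≈_ _≤_ _⊓_)
           {_∧_ : Antichain → Antichain → Antichain} (isMeet : IsMeetSemilattice _≈A_ _≤A_ _∧_)
           (A B : Antichain) where
    open IsMeetSemilattice isMeetSemilattice using (x∧y≤x; x∧y≤y; ∧-greatest)
    open DownSetOfMeet isMeet using (↓-∧⊆; ↓-∧⊇)

    Meets⊆↓∧ : Meets _⊓_ A B ⊆ ↓ (set (A ∧ B))
    Meets⊆↓∧ (a , b , Aa , Bb , y≈a⊓b) =
      ↓-∧⊇ A B ( (a , Aa , trans (reflexive y≈a⊓b) (x∧y≤x a b))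
               , (b , Bb , trans (reflexive y≈a⊓b) (x∧y≤y a b)))

    ∧⊆Max-Meets : set (A ∧ B) ⊆ Max (Meets _⊓_ A B)
    ∧⊆Max-Meets {x} Cx with ↓-∧⊆ A B (x , Cx , refl)
    ... | (a , Aa , x≤a) , (b , Bb , x≤b) =
      (a , b , Aa , Bb , x-max _ (Meets⊆↓∧ (a , b , Aa , Bb , Eq.refl)) (∧-greatest x≤a x≤b))
      , λ y My → x-max y (Meets⊆↓∧ My)
      where
      x-max : ∀ y → ↓ (set (A ∧ B)) y → x ≤ y → x ≈ y
      x-max = proj₂ (antichain⊆Max-↓ (A ∧ B) Cx)

    ∧-≈A-Max-Meets : (A ∧ B) ≈A (Max (Meets _⊓_ A B) , Max-isAntichain (Meets _⊓_ A B))
    ∧-≈A-Max-Meets = (λ (x , Cx , y≤x) → x , ∧⊆Max-Meets Cx , y≤x)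
                   , λ (m , (Mm , _) , y≤m) → let (x , Cx , m≤x) = Meets⊆↓∧ Mm in x , Cx , trans y≤m m≤x

theorem3 : ∀ {c ℓ₁ ℓ₂ : Level} (P : Poset c ℓ₁ ℓ₂) →
  ExcludedMiddle (c ⊔ ℓ₁ ⊔ ℓ₂) →
  let open Poset P
      open AntichainsOf P
  in (IsLatticeA ⇔ MeetCondition)
     × (∀ (_∨_ _∧_ : Antichain → Antichain → Antichain) →
          IsLattice _≈A_ _≤A_ _∨_ _∧_ →
          (∀ A B C → DownMeet A B C → (A ∧ B) ≈A C)
          × IsDistributiveLattice _≈A_ _≤A_ _∨_ _∧_)
     × (∀ (_⊓_ : Carrier → Carrier → Carrier) →
          IsMeetSemilattice _≈_ _≤_ _⊓_ →
          ∀ (_∨_ _∧_ : Antichain → Antichain → Antichain) →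
          IsLattice _≈A_ _≤A_ _∨_ _∧_ →
          ∀ A B → Σ (IsAntichain (Max (Meets _⊓_ A B)))
                    (λ anti → (A ∧ B) ≈A (Max (Meets _⊓_ A B) , anti)))
theorem3 P em =
    mk⇔ isLatticeA⇒meetCondition (meetCondition⇒isLatticeA em)
  , (λ _ _ isLattice → DownSetOfMeet.downMeet⇒≈A-∧ (IsLattice.isMeetSemilattice isLattice)
                     , isDistributive em isLattice)
  , λ _⊓_ isMeetSemilattice _ _ isLattice A B →
      Max-isAntichain (Meets _⊓_ A B)
    , ∧-≈A-Max-Meets isMeetSemilattice (IsLattice.isMeetSemilattice isLattice) A B
  where
  open AntichainsOf P
  open AntichainLattice P
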